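{- For every finite set of assumptions $\Gamma$ and all session contracts $\rho,\sigma$, the execution of $\mathrm{Synth}(\Gamma,\rho,\sigma)$ terminates.
   Context: Names: a countable set $\mathcal N$; co-names $\overline a$ for $a\in\mathcal N$. Session contracts: closed terms of $\sigma::=\mathbf 1\mid a_1.\sigma_1+\cdots+a_n.\sigma_n\mid\overline a_1.\sigma_1\oplus\cdots\oplus\overline a_n.\sigma_n\mid x\mid\mathrm{rec}\,x.\sigma$ ($n\ge1$, $a_i\in\mathcal N$), with the $a_i$ (resp. $\overline a_i$) pairwise distinct in each external (resp. internal) choice and the body of $\mathrm{rec}$ not a variable; recursion is equi-recursive ($\mathrm{rec}\,x.\sigma$ identified with $\sigma\{\mathrm{rec}\,x.\sigma/x\}$), choices modulo commutativity. Orchestration actions: $\langle a,\varepsilon\rangle,\langle a,\overline a\rangle,\langle\varepsilon,a\rangle,\langle\overline a,a\rangle,\langle\overline a,\varepsilon\rangle,\langle\varepsilon,\overline a\rangle$ ($a\in\mathcal N$); orchestrator terms are built from $\mathbf 1$, variables, prefixing $\mu.f$, binary choice $\vee$ and $\mathrm{rec}\,x.f$. An assumption set $\Gamma$ is a finite set of assumptions $x:\rho_i\asymp\sigma_i$ (session contracts $\rho_i,\sigma_i$) with each pair assigned at most one variable. The algorithm $\mathrm{Synth}(\Gamma,\rho,\sigma)$, returning a set of orchestrator terms: 1. If $x:\rho\asymp\sigma\in\Gamma$ for some $x$, return $\{x\}$. 2. Else if $\rho=\mathbf 1$, return $\{\mathbf 1\}$. 3. Otherwise let $\Gamma'=\Gamma,x:\rho\asymp\sigma$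 with $x$ fresh, and: (a) if $\rho=\sum_{i\in I}a_i.\rho_i$, $\sigma=\sum_{j\in J}a_j.\sigma_j$: return $\{\mathrm{rec}\,x.\langle\overline a_i,\varepsilon\rangle.f\mid i\in I,f\in\mathrm{Synth}(\Gamma',\rho_i,\sigma)\}\cup\{\mathrm{rec}\,x.\langle\varepsilon,\overline a_j\rangle.f\mid j\in J,f\in\mathrm{Synth}(\Gamma',\rho,\sigma_j)\}$; (b) if $\rho=\bigoplus_{i\in I}\overline a_i.\rho_i$, $\sigma=\bigoplus_{j\in J}\overline a_j.\sigma_j$: return $\{\mathrm{rec}\,x.\bigvee_{i\in I}\langle a_i,\varepsilon\rangle.f_i\mid f_i\in\mathrm{Synth}(\Gamma',\rho_i,\sigma)\ \forall i\}\cup\{\mathrm{rec}\,x.\bigvee_{j\in J}\langle\varepsilon,a_j\rangle.f_j\mid f_j\in\mathrm{Synth}(\Gamma',\rho,\sigma_j)\ \forall j\}$; (c) if $\rho=\bigoplus_{i\in I}\overline a_i.\rho_i$, $\sigma=\sum_{j\in J}a_j.\sigma_j$: return $\{\mathrm{rec}\,x.(\bigvee_{h\in H}\langle a_h,\varepsilon\rangle.f_h)\vee(\bigvee_{k\in K}\langle a_k,\overline a_k\rangle.f_k)\mid I=H\cup K,K\subseteq J,f_h\in\mathrm{Synth}(\Gamma',\rho_h,\sigma),f_k\in\mathrm{Synth}(\Gamma',\rho_k,\sigma_k)\}\cup\{\mathrm{rec}\,x.\langle\varepsilon,\overline a_j\rangle.f\mid j\in J,f\in\mathrm{Synth}(\Gamma',\rho,\sigma_j)\}$;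 (d) if $\rho=\sum_{i\in I}a_i.\rho_i$, $\sigma=\bigoplus_{j\in J}\overline a_j.\sigma_j$: return $\{\mathrm{rec}\,x.(\bigvee_{h\in H}\langle\varepsilon,a_h\rangle.f_h)\vee(\bigvee_{k\in K}\langle\overline a_k,a_k\rangle.f_k)\mid J=H\cup K,K\subseteq I,f_h\in\mathrm{Synth}(\Gamma',\rho,\sigma_h),f_k\in\mathrm{Synth}(\Gamma',\rho_k,\sigma_k)\}\cup\{\mathrm{rec}\,x.\langle\overline a_i,\varepsilon\rangle.f\mid i\in I,f\in\mathrm{Synth}(\Gamma',\rho_i,\sigma)\}$; (e) otherwise return $\emptyset$. -}

module Defs where

open import Data.Nat using (ℕ; zero; suc; _⊔_)
open import Data.Fin using (Fin; zero; suc)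
open import Data.Product using (_×_; _,_; Σ; ∃; ∃-syntax)
open import Data.List using (List; []; _∷_; map)
open import Data.List.Membership.Propositional using (_∈_)
open import Data.List.Relation.Unary.Unique.Propositional using (Unique)
open import Data.List.Relation.Unary.All using (All)
open import Data.Unit using (⊤)
open import Data.Empty using (⊥)
open import Relation.Nullary using (¬_)

-- Names are natural numbers; co-names are implicit in the internal
-- choice constructor.

Name : Set
Name = ℕ

-- Raw session-contract terms with de Bruijn variables (n = number of
-- bound variables in scope).
--   one        : 1
--   ext bs     : a_1.σ_1 + ... + a_n.σ_n      (bs = list of (a_i , σ_i))
--   int bs     : ā_1.σ_1 ⊕ ... ⊕ ā_n.σ_n      (bs = list of (a_i , σ_i))
--   var i      : variable
--   rec b      : rec x. b

data Term (n : ℕ) : Set where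
  one : Term n
  ext : List (Name × Term n) → Term n
  int : List (Name × Term n) → Term n
  var : Fin n → Term n
  rec : Term (suc n) → Term n

liftR : ∀ {n m} → (Fin n → Fin m) → Fin (suc n) → Fin (suc m)
liftR r zero    = zero
liftR r (suc i) = suc (r i)

mutual
  rename : ∀ {n m} → (Fin n → Fin m) → Term n → Term m
  rename r one      = one
  rename r (ext bs) = ext (renameBs r bs)
  rename r (int bs) = int (renameBs r bs)
  rename r (var i)  = var (r i)
  rename r (rec b)  = rec (rename (liftR r) b)

  renameBs : ∀ {n m} → (Fin n → Fin m) → List (Name × Term n) → List (Name × Term m)
  renameBs r []             = []
  renameBs r ((a , t) ∷ bs) = (a , rename r t) ∷ renameBs r bs

liftS : ∀ {n m} → (Fin n → Term m) → Fin (suc n) → Term (suc m)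
liftS s zero    = var zero
liftS s (suc i) = rename suc (s i)

mutual
  subst : ∀ {n m} → (Fin n → Term m) → Term n → Term m
  subst s one      = one
  subst s (ext bs) = ext (substBs s bs)
  subst s (int bs) = int (substBs s bs)
  subst s (var i)  = s i
  subst s (rec b)  = rec (subst (liftS s) b)

  substBs : ∀ {n m} → (Fin n → Term m) → List (Name × Term n) → List (Name × Term m)
  substBs s []             = []
  substBs s ((a , t) ∷ bs) = (a , subst s t) ∷ substBs s bs

unfoldRec : ∀ {n} → Term (suc n) → Term n
unfoldRec {n} b = subst σ b
  where
  σ : Fin (suc n) → Term n
  σ zero    = rec b
  σ (suc i) = var i

NotVar : ∀ {n} → Term n → Set
NotVar (var _) = ⊥
NotVar _       = ⊤

NonEmpty : ∀ {A : Set} → List A → Set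
NonEmpty []      = ⊥
NonEmpty (_ ∷ _) = ⊤

mutual
  WF : ∀ {n} → Term n → Set
  WF one      = ⊤
  WF (ext bs) = NonEmpty bs × Unique (map (λ p → Data.Product.proj₁ p) bs) × WFBs bs
  WF (int bs) = NonEmpty bs × Unique (map (λ p → Data.Product.proj₁ p) bs) × WFBs bs
  WF (var _)  = ⊤
  WF (rec b)  = NotVar b × WF b

  WFBs : ∀ {n} → List (Name × Term n) → Set
  WFBs []             = ⊤
  WFBs ((_ , t) ∷ bs) = WF t × WFBs bs

record Contract : Set where
  constructor contract
  field
    term : Term 0
    wf   : WF term

data Unf : Term 0 → Term 0 → Set where
  u-one : Unf one one
  u-ext : ∀ {bs} → Unf (ext bs) (ext bs)
  u-int : ∀ {bs} → Unf (int bs) (int bs)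
  u-rec : ∀ {b h} → Unf (unfoldRec b) h → Unf (rec b) h

-- Same set of branches (choices taken modulo commutativity).
SameBranches : (Term 0 → Term 0 → Set) → List (Name × Term 0) → List (Name × Term 0) → Set
SameBranches R bs cs =
  (∀ {a t} → (a , t) ∈ bs → ∃[ u ] ((a , u) ∈ cs × R t u)) ×
  (∀ {a u} → (a , u) ∈ cs → ∃[ t ] ((a , t) ∈ bs × R t u))

-- Equality of the denoted (regular) trees up to depth k.
mutual
  EqN : ℕ → Term 0 → Term 0 → Set
  EqN zero    _ _ = ⊤
  EqN (suc k) t u = ∃[ h ] ∃[ h' ] (Unf t h × Unf u h' × HeadEq k h h')

  HeadEq : ℕ → Term 0 → Term 0 → Set
  HeadEq k one      one      = ⊤
  HeadEq k (ext bs) (ext cs) = SameBranches (EqN k) bs cs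
  HeadEq k (int bs) (int cs) = SameBranches (EqN k) bs cs
  HeadEq k _        _        = ⊥

-- Identification of contracts: equi-recursion + commutativity of choices.
_≈_ : Term 0 → Term 0 → Set
t ≈ u = ∀ k → EqN k t u

record Assumption : Set where
  constructor _∶_≍_
  field
    avar : ℕ
    lhs  : Term 0
    rhs  : Term 0

Ctx : Set
Ctx = List Assumption

WFCtx : Ctx → Set
WFCtx Γ = All (λ A → WF (Assumption.lhs A) × WF (Assumption.rhs A)) Γ

InCtx : Ctx → Term 0 → Term 0 → Set
InCtx Γ ρ σ = ∃[ x ] ∃[ ρ' ] ∃[ σ' ] ((x ∶ ρ' ≍ σ') ∈ Γ × ρ ≈ ρ' × σ ≈ σ')

fresh : Ctx → ℕ
fresh []                  = 0
fresh ((x ∶ _ ≍ _) ∷ Γ)   = suc x ⊔ fresh Γ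

extendCtx : Ctx → Term 0 → Term 0 → Ctx
extendCtx Γ ρ σ = (fresh Γ ∶ ρ ≍ σ) ∷ Γ

IsChoice : Term 0 → Set
IsChoice t = (∃[ bs ] Unf t (ext bs)) Data.Sum.⊎ (∃[ bs ] Unf t (int bs))
  where import Data.Sum

-- Termination of Synth (Bove–Capretta domain predicate): SynthHalts Γ ρ σ
-- holds iff the execution of Synth(Γ,ρ,σ) terminates, i.e. it stops at
-- step 1, 2 or 3(e), or it reaches one of steps 3(a)-(d) and every
-- recursive call performed there terminates.

data SynthHalts (Γ : Ctx) (ρ σ : Term 0) : Set where
  s-hyp : InCtx Γ ρ σ → SynthHalts Γ ρ σ
  s-one : ¬ InCtx Γ ρ σ → Unf ρ one → SynthHalts Γ ρ σ
  s-ext-ext : ∀ {bs cs} → ¬ InCtx Γ ρ σ → Unf ρ (ext bs) → Unf σ (ext cs) →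
    (∀ {a ρi} → (a , ρi) ∈ bs → SynthHalts (extendCtx Γ ρ σ) ρi σ) →
    (∀ {a σj} → (a , σj) ∈ cs → SynthHalts (extendCtx Γ ρ σ) ρ σj) →
    SynthHalts Γ ρ σ
  s-int-int : ∀ {bs cs} → ¬ InCtx Γ ρ σ → Unf ρ (int bs) → Unf σ (int cs) →
    (∀ {a ρi} → (a , ρi) ∈ bs → SynthHalts (extendCtx Γ ρ σ) ρi σ) →
    (∀ {a σj} → (a , σj) ∈ cs → SynthHalts (extendCtx Γ ρ σ) ρ σj) →
    SynthHalts Γ ρ σ
  s-int-ext : ∀ {bs cs} → ¬ InCtx Γ ρ σ → Unf ρ (int bs) → Unf σ (ext cs) →
    (∀ {a ρh} → (a , ρh) ∈ bs → SynthHalts (extendCtx Γ ρ σ) ρh σ) →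
    (∀ {a ρk σk} → (a , ρk) ∈ bs → (a , σk) ∈ cs → SynthHalts (extendCtx Γ ρ σ) ρk σk) →
    (∀ {a σj} → (a , σj) ∈ cs → SynthHalts (extendCtx Γ ρ σ) ρ σj) →
    SynthHalts Γ ρ σ
  s-ext-int : ∀ {bs cs} → ¬ InCtx Γ ρ σ → Unf ρ (ext bs) → Unf σ (int cs) →
    (∀ {a σh} → (a , σh) ∈ cs → SynthHalts (extendCtx Γ ρ σ) ρ σh) →
    (∀ {a ρk σk} → (a , ρk) ∈ bs → (a , σk) ∈ cs → SynthHalts (extendCtx Γ ρ σ) ρk σk) →
    (∀ {a ρi} → (a , ρi) ∈ bs → SynthHalts (extendCtx Γ ρ σ) ρi σ) →
    SynthHalts Γ ρ σ
  s-other : ¬ InCtx Γ ρ σ → ¬ Unf ρ one → ¬ (IsChoice ρ × IsChoice σ) →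
    SynthHalts Γ ρ σ

module Submission where

-- Every call of Synth that does not stop at step 1 adds its own pair
-- (ρ, σ) to Γ and recurses on pairs of continuations of ρ and σ.  A well-formed closed contract t lies in a finite list
--    cl t closed under "unfold the rec-prefixes, then take a branch".  On closed lists the depth-k equality EqN k
--    is decidable by induction on k, and the descending chain
--    EqN 0 ⊇ EqN 1 ⊇ … stabilises on the finitely many pairs; hence ≈, and
--    with it the test of step 1 (membership in Γ up to ≈), is decidable.
--  * Measure.  The number of pairs of cl ρ × cl σ not yet assumed in Γ
--    strictly decreases along every recursive call, so Synth halts by
--    induction on that number.

open import Defs
open import Function using (_∘_; id; const; case_of_)
open import Data.Nat using (ℕ; _≟_; zero; suc; _≤_; _<_; _≤′_; ≤′-refl; ≤′-step; z≤n; s≤s)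
open import Data.Nat.Properties using (≤-refl; ≤-trans; <-≤-trans; ≤-pred; ≤-total; ≤⇒≤′; m≤n⇒m≤1+n)
open import Data.Fin using (Fin; zero; suc)
open import Data.Product using (_×_; _,_; ∃-syntax; proj₁; proj₂)
open import Data.Sum using (_⊎_; inj₁; inj₂)
open import Data.List using (List; []; _∷_; _++_; length; lookup; allFin; cartesianProduct)
open import Data.List.Membership.Propositional using (_∈_; lose)
open import Data.List.Membership.Propositional.Properties
  using (∈-++⁺ˡ; ∈-++⁺ʳ; ∈-++⁻; ∈-lookup; ∈-allFin; ∈-cartesianProduct⁺)
open import Data.List.Relation.Binary.Subset.Propositional using (_⊆_)
open import Data.List.Relation.Unary.Any using (Any; here; there; index)
open import Data.List.Relation.Unary.Any.Properties using (lookup-index)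
open import Data.List.Relation.Unary.All using (All; []; _∷_)
import Data.List.Relation.Unary.All as All
open import Data.Unit using (tt)
open import Data.Empty using (⊥-elim)
open import Relation.Nullary using (¬_; Dec; yes; no)
open import Relation.Nullary.Decidable using (map′; _×-dec_; _⊎-dec_; ¬?)
open import Relation.Binary.PropositionalEquality
  using (_≡_; _≗_; refl; sym; trans; cong; cong₂)
  renaming (subst to transport; subst₂ to transport₂)

private
  variable
    n m k : ℕ

-- Substitution algebra: congruence and fusion laws for rename and subst.

liftR-cong : {r r' : Fin n → Fin m} → r ≗ r' → liftR r ≗ liftR r'
liftR-cong e zero    = refl
liftR-cong e (suc i) = cong suc (e i)

mutual
  rename-cong : {r r' : Fin n → Fin m} → r ≗ r' → rename r ≗ rename r'
  rename-cong e one      = refl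
  rename-cong e (ext bs) = cong ext (renameBs-cong e bs)
  rename-cong e (int bs) = cong int (renameBs-cong e bs)
  rename-cong e (var i)  = cong var (e i)
  rename-cong e (rec b)  = cong rec (rename-cong (liftR-cong e) b)

  renameBs-cong : {r r' : Fin n → Fin m} → r ≗ r' → renameBs r ≗ renameBs r'
  renameBs-cong e []             = refl
  renameBs-cong e ((a , t) ∷ bs) = cong₂ (λ t' bs' → (a , t') ∷ bs') (rename-cong e t) (renameBs-cong e bs)

mutual
  rename-rename : (r : Fin m → Fin k) (r' : Fin n → Fin m) →
    rename r ∘ rename r' ≗ rename (r ∘ r')
  rename-rename r r' one      = refl
  rename-rename r r' (ext bs) = cong ext (renameBs-rename r r' bs)
  rename-rename r r' (int bs) = cong int (renameBs-rename r r' bs)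
  rename-rename r r' (var i)  = refl
  rename-rename r r' (rec b)  =
    cong rec (trans (rename-rename (liftR r) (liftR r') b) (rename-cong lift-∘ b))
    where
    lift-∘ : liftR r ∘ liftR r' ≗ liftR (r ∘ r')
    lift-∘ zero    = refl
    lift-∘ (suc i) = refl

  renameBs-rename : (r : Fin m → Fin k) (r' : Fin n → Fin m) →
    renameBs r ∘ renameBs r' ≗ renameBs (r ∘ r')
  renameBs-rename r r' []             = refl
  renameBs-rename r r' ((a , t) ∷ bs) =
    cong₂ (λ t' bs' → (a , t') ∷ bs') (rename-rename r r' t) (renameBs-rename r r' bs)

liftS-cong : {s s' : Fin n → Term m} → s ≗ s' → liftS s ≗ liftS s'
liftS-cong e zero    = refl
liftS-cong e (suc i) = cong (rename suc) (e i)

mutual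
  subst-cong : {s s' : Fin n → Term m} → s ≗ s' → subst s ≗ subst s'
  subst-cong e one      = refl
  subst-cong e (ext bs) = cong ext (substBs-cong e bs)
  subst-cong e (int bs) = cong int (substBs-cong e bs)
  subst-cong e (var i)  = e i
  subst-cong e (rec b)  = cong rec (subst-cong (liftS-cong e) b)

  substBs-cong : {s s' : Fin n → Term m} → s ≗ s' → substBs s ≗ substBs s'
  substBs-cong e []             = refl
  substBs-cong e ((a , t) ∷ bs) = cong₂ (λ t' bs' → (a , t') ∷ bs') (subst-cong e t) (substBs-cong e bs)

mutual
  subst-rename : (s : Fin m → Term k) (r : Fin n → Fin m) →
    subst s ∘ rename r ≗ subst (s ∘ r)
  subst-rename s r one      = refl
  subst-rename s r (ext bs) = cong ext (substBs-rename s r bs)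
  subst-rename s r (int bs) = cong int (substBs-rename s r bs)
  subst-rename s r (var i)  = refl
  subst-rename s r (rec b)  =
    cong rec (trans (subst-rename (liftS s) (liftR r) b) (subst-cong lift-∘ b))
    where
    lift-∘ : liftS s ∘ liftR r ≗ liftS (s ∘ r)
    lift-∘ zero    = refl
    lift-∘ (suc i) = refl

  substBs-rename : (s : Fin m → Term k) (r : Fin n → Fin m) →
    substBs s ∘ renameBs r ≗ substBs (s ∘ r)
  substBs-rename s r []             = refl
  substBs-rename s r ((a , t) ∷ bs) =
    cong₂ (λ t' bs' → (a , t') ∷ bs') (subst-rename s r t) (substBs-rename s r bs)

mutual
  rename-subst : (r : Fin m → Fin k) (s : Fin n → Term m) →
    rename r ∘ subst s ≗ subst (rename r ∘ s)
  rename-subst r s one      = refl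
  rename-subst r s (ext bs) = cong ext (renameBs-subst r s bs)
  rename-subst r s (int bs) = cong int (renameBs-subst r s bs)
  rename-subst r s (var i)  = refl
  rename-subst r s (rec b)  =
    cong rec (trans (rename-subst (liftR r) (liftS s) b) (subst-cong lift-∘ b))
    where
    lift-∘ : rename (liftR r) ∘ liftS s ≗ liftS (rename r ∘ s)
    lift-∘ zero    = refl
    lift-∘ (suc i) = trans (rename-rename (liftR r) suc (s i)) (sym (rename-rename suc r (s i)))

  renameBs-subst : (r : Fin m → Fin k) (s : Fin n → Term m) →
    renameBs r ∘ substBs s ≗ substBs (rename r ∘ s)
  renameBs-subst r s []             = refl
  renameBs-subst r s ((a , t) ∷ bs) =
    cong₂ (λ t' bs' → (a , t') ∷ bs') (rename-subst r s t) (renameBs-subst r s bs)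

mutual
  subst-subst : (s : Fin m → Term k) (τ : Fin n → Term m) →
    subst s ∘ subst τ ≗ subst (subst s ∘ τ)
  subst-subst s τ one      = refl
  subst-subst s τ (ext bs) = cong ext (substBs-subst s τ bs)
  subst-subst s τ (int bs) = cong int (substBs-subst s τ bs)
  subst-subst s τ (var i)  = refl
  subst-subst s τ (rec b)  =
    cong rec (trans (subst-subst (liftS s) (liftS τ) b) (subst-cong lift-∘ b))
    where
    lift-∘ : subst (liftS s) ∘ liftS τ ≗ liftS (subst s ∘ τ)
    lift-∘ zero    = refl
    lift-∘ (suc i) = trans (subst-rename (liftS s) suc (τ i)) (sym (rename-subst suc s (τ i)))

  substBs-subst : (s : Fin m → Term k) (τ : Fin n → Term m) →
    substBs s ∘ substBs τ ≗ substBs (subst s ∘ τ)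
  substBs-subst s τ []             = refl
  substBs-subst s τ ((a , t) ∷ bs) =
    cong₂ (λ t' bs' → (a , t') ∷ bs') (subst-subst s τ t) (substBs-subst s τ bs)

mutual
  subst-id : (s : Fin n → Term n) → s ≗ var → subst s ≗ id
  subst-id s e one      = refl
  subst-id s e (ext bs) = cong ext (substBs-id s e bs)
  subst-id s e (int bs) = cong int (substBs-id s e bs)
  subst-id s e (var i)  = e i
  subst-id s e (rec b)  = cong rec (subst-id (liftS s) lift-var b)
    where
    lift-var : liftS s ≗ var
    lift-var zero    = refl
    lift-var (suc i) = cong (rename suc) (e i)

  substBs-id : (s : Fin n → Term n) → s ≗ var → substBs s ≗ id
  substBs-id s e []             = refl
  substBs-id s e ((a , t) ∷ bs) = cong₂ (λ t' bs' → (a , t') ∷ bs') (subst-id s e t) (substBs-id s e bs)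

extend : (Fin n → Term 0) → Term 0 → Fin (suc n) → Term 0
extend θ t zero    = t
extend θ t (suc i) = θ i

unfold-subst : (θ : Fin n → Term 0) (b : Term (suc n)) →
  unfoldRec (subst (liftS θ) b) ≡ subst (extend θ (subst θ (rec b))) b
unfold-subst θ b = fuse _ refl
  where
  fuse : (s : Fin 1 → Term 0) → s zero ≡ rec (subst (liftS θ) b) →
    subst s (subst (liftS θ) b) ≡ subst (extend θ (subst θ (rec b))) b
  fuse s s-zero = trans (subst-subst s (liftS θ) b) (subst-cong agree b)
    where
    agree : subst s ∘ liftS θ ≗ extend θ (subst θ (rec b))
    agree zero    = s-zero
    agree (suc i) = trans (subst-rename s suc (θ i)) (subst-id _ (λ ()) (θ i))

data IsHead : Term 0 → Set where
  h-one : IsHead one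
  h-ext : ∀ bs → IsHead (ext bs)
  h-int : ∀ bs → IsHead (int bs)

unf-head : ∀ {t h} → Unf t h → IsHead h
unf-head u-one     = h-one
unf-head u-ext     = h-ext _
unf-head u-int     = h-int _
unf-head (u-rec U) = unf-head U

unf-det : ∀ {t h h'} → Unf t h → Unf t h' → h ≡ h'
unf-det u-one     u-one     = refl
unf-det u-ext     u-ext     = refl
unf-det u-int     u-int     = refl
unf-det (u-rec U) (u-rec V) = unf-det U V

one-not-choice : ∀ {t} → Unf t one → ¬ IsChoice t
one-not-choice U (inj₁ (_ , V)) = case unf-det U V of λ ()
one-not-choice U (inj₂ (_ , V)) = case unf-det U V of λ ()

branches : Term 0 → List (Name × Term 0)
branches (ext bs) = bs
branches (int bs) = bs
branches _        = []

BranchesIn : Term 0 → List (Term 0) → Set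
BranchesIn h L = ∀ {a t} → (a , t) ∈ branches h → t ∈ L

UnfoldsInto : List (Term 0) → Term 0 → Set
UnfoldsInto L s = ∃[ h ] (Unf s h × BranchesIn h L)

UnfoldsInto-mono : ∀ {L L' s} → L ⊆ L' → UnfoldsInto L s → UnfoldsInto L' s
UnfoldsInto-mono L⊆L' (h , U , c) = h , U , L⊆L' ∘ c

branchesIn : ∀ {L s h} → UnfoldsInto L s → Unf s h → BranchesIn h L
branchesIn (h , U , c) V rewrite unf-det V U = c

Closed : List (Term 0) → Set
Closed L = ∀ {s} → s ∈ L → UnfoldsInto L s

Regular : Term 0 → Set
Regular t = ∃[ L ] (Closed L × t ∈ L)

-- Finite closures of well-formed contracts.

-- closure t θ: the states reachable from t under the closing substitution θ;
-- its head is the closed term itself.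
mutual
  closure : Term n → (Fin n → Term 0) → List (Term 0)
  closure t θ = subst θ t ∷ below t θ

  below : Term n → (Fin n → Term 0) → List (Term 0)
  below one      θ = []
  below (ext bs) θ = closureBs bs θ
  below (int bs) θ = closureBs bs θ
  below (var i)  θ = []
  below (rec b)  θ = closure b (extend θ (subst θ (rec b)))

  closureBs : List (Name × Term n) → (Fin n → Term 0) → List (Term 0)
  closureBs []             θ = []
  closureBs ((a , t) ∷ bs) θ = closure t θ ++ closureBs bs θ

branch∈closure : (θ : Fin n → Term 0) (bs : List (Name × Term n)) →
  ∀ {a t} → (a , t) ∈ substBs θ bs → t ∈ closureBs bs θ
branch∈closure θ ((_ , t) ∷ bs) (here refl) = here refl
branch∈closure θ ((_ , t) ∷ bs) (there m)   = ∈-++⁺ʳ (closure t θ) (branch∈closure θ bs m)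

unfoldsInto : (t : Term n) (θ : Fin n → Term 0) → NotVar t → WF t →
  UnfoldsInto (closure t θ) (subst θ t)
unfoldsInto one      θ _ _ = one , u-one , λ ()
unfoldsInto (ext bs) θ _ _ = ext _ , u-ext , there ∘ branch∈closure θ bs
unfoldsInto (int bs) θ _ _ = int _ , u-int , there ∘ branch∈closure θ bs
unfoldsInto (rec b)  θ _ (nv , wf)
  with h , U , c ← unfoldsInto b (extend θ (subst θ (rec b))) nv wf =
  h , u-rec (transport (λ t → Unf t h) (sym (unfold-subst θ b)) U) , there ∘ c

mutual
  closure-unfolds : ∀ {L} (t : Term n) θ → WF t → (∀ i → UnfoldsInto L (θ i)) →
    closure t θ ⊆ L → ∀ {s} → s ∈ closure t θ → UnfoldsInto L s
  closure-unfolds (var i)  θ wf hθ sub (here refl) = hθ i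
  closure-unfolds one      θ wf hθ sub (here refl) = UnfoldsInto-mono sub (unfoldsInto one θ tt wf)
  closure-unfolds (ext bs) θ wf hθ sub (here refl) = UnfoldsInto-mono sub (unfoldsInto (ext bs) θ tt wf)
  closure-unfolds (int bs) θ wf hθ sub (here refl) = UnfoldsInto-mono sub (unfoldsInto (int bs) θ tt wf)
  closure-unfolds (rec b)  θ wf hθ sub (here refl) = UnfoldsInto-mono sub (unfoldsInto (rec b) θ tt wf)
  closure-unfolds (ext bs) θ (_ , _ , wf) hθ sub (there m) = closureBs-unfolds bs θ wf hθ (sub ∘ there) m
  closure-unfolds (int bs) θ (_ , _ , wf) hθ sub (there m) = closureBs-unfolds bs θ wf hθ (sub ∘ there) m
  closure-unfolds {L = L} (rec b) θ wf hθ sub (there m) =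
    closure-unfolds b (extend θ (subst θ (rec b))) (proj₂ wf) hθ' (sub ∘ there) m
    where
    hθ' : ∀ i → UnfoldsInto L (extend θ (subst θ (rec b)) i)
    hθ' zero    = UnfoldsInto-mono sub (unfoldsInto (rec b) θ tt wf)
    hθ' (suc i) = hθ i

  closureBs-unfolds : ∀ {L} (bs : List (Name × Term n)) θ → WFBs bs → (∀ i → UnfoldsInto L (θ i)) →
    closureBs bs θ ⊆ L → ∀ {s} → s ∈ closureBs bs θ → UnfoldsInto L s
  closureBs-unfolds ((_ , t) ∷ bs) θ (wt , wbs) hθ sub m with ∈-++⁻ (closure t θ) m
  ... | inj₁ m₁ = closure-unfolds t θ wt hθ (sub ∘ ∈-++⁺ˡ) m₁
  ... | inj₂ m₂ = closureBs-unfolds bs θ wbs hθ (sub ∘ ∈-++⁺ʳ (closure t θ)) m₂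

cl : Term 0 → List (Term 0)
cl t = closure t (λ ())

cl-closed : (t : Term 0) → WF t → Closed (cl t)
cl-closed t wf = closure-unfolds t (λ ()) wf (λ ()) id

∈cl : (t : Term 0) → t ∈ cl t
∈cl t = transport (_∈ cl t) (subst-id (λ ()) (λ ()) t) (here refl)

regular : (t : Term 0) → WF t → Regular t
regular t wf = cl t , cl-closed t wf , ∈cl t

-- Finite enumerations: counting and stabilisation of descending chains.

module _ {A : Set} where

  count : {P : A → Set} → (∀ x → Dec (P x)) → List A → ℕ
  count P? [] = 0
  count P? (x ∷ xs) with P? x
  ... | yes _ = suc (count P? xs)
  ... | no _  = count P? xs

  count-mono : {P Q : A → Set} (P? : ∀ x → Dec (P x)) (Q? : ∀ x → Dec (Q x)) →
    (∀ {x} → Q x → P x) → ∀ xs → count Q? xs ≤ count P? xs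
  count-mono P? Q? Q⇒P [] = z≤n
  count-mono P? Q? Q⇒P (x ∷ xs) with P? x | Q? x
  ... | yes _ | yes _ = s≤s (count-mono P? Q? Q⇒P xs)
  ... | yes _ | no _  = m≤n⇒m≤1+n (count-mono P? Q? Q⇒P xs)
  ... | no ¬p | yes q = ⊥-elim (¬p (Q⇒P q))
  ... | no _  | no _  = count-mono P? Q? Q⇒P xs

  count-< : {P Q : A → Set} (P? : ∀ x → Dec (P x)) (Q? : ∀ x → Dec (Q x)) →
    (∀ {x} → Q x → P x) → ∀ {xs} → Any (λ x → P x × ¬ Q x) xs → count Q? xs < count P? xs
  count-< P? Q? Q⇒P {x ∷ xs} gap with P? x | Q? x | gap
  ... | yes _ | no _  | here _        = s≤s (count-mono P? Q? Q⇒P xs)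
  ... | _     | yes q | here (_ , ¬q) = ⊥-elim (¬q q)
  ... | no ¬p | _     | here (p , _)  = ⊥-elim (¬p p)
  ... | yes _ | yes _ | there gap'    = s≤s (count-< P? Q? Q⇒P gap')
  ... | yes _ | no _  | there gap'    = m≤n⇒m≤1+n (count-< P? Q? Q⇒P gap')
  ... | no ¬p | yes q | there _       = ⊥-elim (¬p (Q⇒P q))
  ... | no _  | no _  | there gap'    = count-< P? Q? Q⇒P gap'

module Stabilisation {A : Set} (P : ℕ → A → Set) (P? : ∀ k x → Dec (P k x))
                     (descending : ∀ {k x} → P (suc k) x → P k x) where

  Stable : ℕ → A → Set
  Stable k x = P k x → P (suc k) x

  stable-or-drop : ∀ k xs → All (Stable k) xs ⊎ Any (λ x → P k x × ¬ P (suc k) x) xs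
  stable-or-drop k [] = inj₁ []
  stable-or-drop k (x ∷ xs) with P? k x | P? (suc k) x | stable-or-drop k xs
  ... | yes p | no ¬q | _       = inj₂ (here (p , ¬q))
  ... | _     | _     | inj₂ d  = inj₂ (there d)
  ... | yes _ | yes q | inj₁ st = inj₁ (const q ∷ st)
  ... | no ¬p | _     | inj₁ st = inj₁ ((⊥-elim ∘ ¬p) ∷ st)

  -- each drop lowers the count of P k on xs, which starts at count (P 0)
  stabilises : ∀ xs → ∃[ k ] All (Stable k) xs
  stabilises xs = search (count (P? 0) xs) 0 ≤-refl
    where
    search : ∀ fuel k → count (P? k) xs ≤ fuel → ∃[ k ] All (Stable k) xs
    search fuel k bound with stable-or-drop k xs
    ... | inj₁ st = k , st
    ... | inj₂ drop with fuel | ≤-trans (count-< (P? k) (P? (suc k)) descending drop) bound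
    ...   | zero      | ()
    ...   | suc fuel' | lt = search fuel' (suc k) (≤-pred lt)

module PairsOf {A B : Set} (L₁ : List A) (L₂ : List B) where

  Pair : Set
  Pair = Fin (length L₁) × Fin (length L₂)

  pairs : List Pair
  pairs = cartesianProduct (allFin _) (allFin _)

  fst : Pair → A
  fst (i , _) = lookup L₁ i

  snd : Pair → B
  snd (_ , j) = lookup L₂ j

  fst∈ : (p : Pair) → fst p ∈ L₁
  fst∈ (i , _) = ∈-lookup i

  snd∈ : (p : Pair) → snd p ∈ L₂
  snd∈ (_ , j) = ∈-lookup j

  position∈ : ∀ {s u} (ms : s ∈ L₁) (mu : u ∈ L₂) → (index ms , index mu) ∈ pairs
  position∈ ms mu = ∈-cartesianProduct⁺ (∈-allFin _) (∈-allFin _)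

  all-at : (R : A → B → Set) → All (λ p → R (fst p) (snd p)) pairs →
    ∀ {s u} → s ∈ L₁ → u ∈ L₂ → R s u
  all-at R all ms mu =
    transport₂ R (sym (lookup-index ms)) (sym (lookup-index mu)) (All.lookup all (position∈ ms mu))

  any-at : (R : A → B → Set) → ∀ {s u} → s ∈ L₁ → u ∈ L₂ → R s u →
    Any (λ p → R (fst p) (snd p)) pairs
  any-at R ms mu r = lose (position∈ ms mu) (transport₂ R (lookup-index ms) (lookup-index mu) r)

SameBranches-map : ∀ {R R' : Term 0 → Term 0 → Set} {bs cs} →
  (∀ {a t b u} → (a , t) ∈ bs → (b , u) ∈ cs → R t u → R' t u) →
  SameBranches R bs cs → SameBranches R' bs cs
SameBranches-map f (to , from) =
  (λ m → let u , m' , r = to m in u , m' , f m m' r) ,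
  (λ m → let t , m' , r = from m in t , m' , f m' m r)

HeadEq-map : ∀ {j k h h'} → IsHead h → IsHead h' →
  (∀ {a t b u} → (a , t) ∈ branches h → (b , u) ∈ branches h' → EqN j t u → EqN k t u) →
  HeadEq j h h' → HeadEq k h h'
HeadEq-map h-one     h-one     f _ = tt
HeadEq-map (h-ext _) (h-ext _) f e = SameBranches-map f e
HeadEq-map (h-int _) (h-int _) f e = SameBranches-map f e
HeadEq-map h-one     (h-ext _) f ()
HeadEq-map h-one     (h-int _) f ()
HeadEq-map (h-ext _) h-one     f ()
HeadEq-map (h-ext _) (h-int _) f ()
HeadEq-map (h-int _) h-one     f ()
HeadEq-map (h-int _) (h-ext _) f ()

EqN-antitone : ∀ {k t u} → EqN (suc k) t u → EqN k t u
EqN-antitone {zero}  _                      = tt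
EqN-antitone {suc k} (h , h' , U , U' , e) =
  h , h' , U , U' , HeadEq-map (unf-head U) (unf-head U') (λ _ _ → EqN-antitone) e

EqN-≤′ : ∀ {j k t u} → j ≤′ k → EqN k t u → EqN j t u
EqN-≤′ ≤′-refl         e = e
EqN-≤′ (≤′-step j≤′k) e = EqN-≤′ j≤′k (EqN-antitone e)

≈-refl : ∀ {L} → Closed L → ∀ {s} → s ∈ L → s ≈ s
≈-refl {L} closed ms k = go k ms
  where
  go : ∀ k {s} → s ∈ L → EqN k s s
  go zero    _  = tt
  go (suc k) ms with h , U , c ← closed ms = h , h , U , U , diag (unf-head U) c
    where
    diag : ∀ {h} → IsHead h → BranchesIn h L → HeadEq k h h
    diag h-one     _ = tt
    diag (h-ext _) c = (λ m → _ , m , go k (c m)) , (λ m → _ , m , go k (c m))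
    diag (h-int _) c = (λ m → _ , m , go k (c m)) , (λ m → _ , m , go k (c m))

∀∈? : {A : Set} {P : A → Set} (xs : List A) → (∀ {x} → x ∈ xs → Dec (P x)) →
  Dec (∀ {x} → x ∈ xs → P x)
∀∈? []       d = yes λ ()
∀∈? (x ∷ xs) d =
  map′ (λ (p , ps) → λ { {_} (here refl) → p ; {_} (there m) → ps m })
       (λ f → f (here refl) , λ {_} m → f (there m))
       (d (here refl) ×-dec ∀∈? xs (λ {_} m → d (there m)))

label∃? : {B : Set} {P : B → Set} (cs : List (Name × B)) (a : Name) →
  (∀ {u} → (a , u) ∈ cs → Dec (P u)) → Dec (∃[ u ] ((a , u) ∈ cs × P u))
label∃? []              a d = no λ ()
label∃? {P = P} ((a' , u) ∷ cs) a d with a ≟ a'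
... | yes refl = map′ found (λ { (_ , here refl , p) → inj₁ p ; (u' , there m , p) → inj₂ (u' , m , p) })
                      (d (here refl) ⊎-dec label∃? cs a (λ m → d (there m)))
  where
  found : P u ⊎ ∃[ u' ] ((a , u') ∈ cs × P u') → ∃[ u' ] ((a , u') ∈ (a , u) ∷ cs × P u')
  found (inj₁ p)            = u , here refl , p
  found (inj₂ (u' , m , p)) = u' , there m , p
... | no a≢a' = map′ (λ (u' , m , p) → u' , there m , p)
                     (λ { (_ , here refl , _) → ⊥-elim (a≢a' refl) ; (u' , there m , p) → u' , m , p })
                     (label∃? cs a (λ m → d (there m)))

SameBranches? : ∀ {R : Term 0 → Term 0 → Set} bs cs →
  (∀ {a t b u} → (a , t) ∈ bs → (b , u) ∈ cs → Dec (R t u)) → Dec (SameBranches R bs cs)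
SameBranches? bs cs d =
  map′ (λ (to , from) → (λ {a} {t} → to {a , t}) , (λ {a} {u} → from {a , u}))
       (λ (to , from) → (λ {x} → to {proj₁ x} {proj₂ x}) , (λ {x} → from {proj₁ x} {proj₂ x}))
    (∀∈? bs (λ m → label∃? cs _ (λ m' → d m m')) ×-dec
     ∀∈? cs (λ m → label∃? bs _ (λ m' → d m' m)))

HeadEq? : ∀ {k h h'} → IsHead h → IsHead h' →
  (∀ {a t b u} → (a , t) ∈ branches h → (b , u) ∈ branches h' → Dec (EqN k t u)) →
  Dec (HeadEq k h h')
HeadEq? h-one      h-one      d = yes tt
HeadEq? (h-ext bs) (h-ext cs) d = SameBranches? bs cs d
HeadEq? (h-int bs) (h-int cs) d = SameBranches? bs cs d
HeadEq? h-one      (h-ext _)  d = no λ ()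
HeadEq? h-one      (h-int _)  d = no λ ()
HeadEq? (h-ext _)  h-one      d = no λ ()
HeadEq? (h-ext _)  (h-int _)  d = no λ ()
HeadEq? (h-int _)  h-one      d = no λ ()
HeadEq? (h-int _)  (h-ext _)  d = no λ ()

-- Decidability of ≈ on closed lists.

module Bisimilarity {L₁ L₂ : List (Term 0)} (closed₁ : Closed L₁) (closed₂ : Closed L₂) where

  EqN? : ∀ k {s u} → s ∈ L₁ → u ∈ L₂ → Dec (EqN k s u)
  EqN? zero    _  _  = yes tt
  EqN? (suc k) ms mu with h , U , c ← closed₁ ms | h' , U' , c' ← closed₂ mu =
    map′ (λ e → h , h' , U , U' , e)
         (λ (g , g' , V , V' , e) → transport₂ (HeadEq k) (unf-det V U) (unf-det V' U') e)
         (HeadEq? (unf-head U) (unf-head U') (λ m m' → EqN? k (c m) (c' m')))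

  stable⇒≈ : ∀ {k} → (∀ {s u} → s ∈ L₁ → u ∈ L₂ → EqN k s u → EqN (suc k) s u) →
    ∀ {s u} → s ∈ L₁ → u ∈ L₂ → EqN k s u → s ≈ u
  stable⇒≈ {k} stable ms mu e j with ≤-total j k
  ... | inj₁ j≤k = EqN-≤′ (≤⇒≤′ j≤k) e
  ... | inj₂ k≤j = lift (≤⇒≤′ k≤j) ms mu e
    where
    lift : ∀ {j s u} → k ≤′ j → s ∈ L₁ → u ∈ L₂ → EqN k s u → EqN j s u
    lift ≤′-refl         _  _  e = e
    lift (≤′-step k≤′j) ms mu e with h , h' , U , U' , he ← stable ms mu e =
      h , h' , U , U' ,
      HeadEq-map (unf-head U) (unf-head U')
        (λ m m' → lift k≤′j (branchesIn (closed₁ ms) U m) (branchesIn (closed₂ mu) U' m')) he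

  open PairsOf L₁ L₂

  EqAt : ℕ → Pair → Set
  EqAt k p = EqN k (fst p) (snd p)

  open Stabilisation EqAt (λ k p → EqN? k (fst∈ p) (snd∈ p)) EqN-antitone

  -- decide ≈ at a depth where the chain EqAt has become stationary
  ≈? : ∀ {s u} → s ∈ L₁ → u ∈ L₂ → Dec (s ≈ u)
  ≈? ms mu with k , stable ← stabilises pairs =
    map′ (stable⇒≈ (all-at (λ s u → EqN k s u → EqN (suc k) s u) stable) ms mu) (λ e → e k)
         (EqN? k ms mu)

≈?-regular : ∀ {s u} → Regular s → Regular u → Dec (s ≈ u)
≈?-regular (_ , closed₁ , ms) (_ , closed₂ , mu) = Bisimilarity.≈? closed₁ closed₂ ms mu

RegularCtx : Ctx → Set
RegularCtx = All (λ A → Regular (Assumption.lhs A) × Regular (Assumption.rhs A))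

InCtx-there : ∀ {Γ A ρ σ} → InCtx Γ ρ σ → InCtx (A ∷ Γ) ρ σ
InCtx-there (x , ρ' , σ' , m , e₁ , e₂) = x , ρ' , σ' , there m , e₁ , e₂

InCtx? : ∀ {Γ ρ σ} → RegularCtx Γ → Regular ρ → Regular σ → Dec (InCtx Γ ρ σ)
InCtx? []                     _  _  = no λ ()
InCtx? {(x ∶ ρ' ≍ σ') ∷ Γ} {ρ} {σ} ((r₁ , r₂) ∷ reg) rρ rσ =
  map′ to from (≈?-regular rρ r₁ ×-dec ≈?-regular rσ r₂ ⊎-dec InCtx? reg rρ rσ)
  where
  to : (ρ ≈ ρ' × σ ≈ σ') ⊎ InCtx Γ ρ σ → InCtx ((x ∶ ρ' ≍ σ') ∷ Γ) ρ σ
  to (inj₁ (e₁ , e₂)) = x , ρ' , σ' , here refl , e₁ , e₂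
  to (inj₂ i)         = InCtx-there i
  from : InCtx ((x ∶ ρ' ≍ σ') ∷ Γ) ρ σ → (ρ ≈ ρ' × σ ≈ σ') ⊎ InCtx Γ ρ σ
  from (_ , _ , _ , here refl , e₁ , e₂) = inj₁ (e₁ , e₂)
  from (y , τ , υ , there m , e₁ , e₂)   = inj₂ (y , τ , υ , m , e₁ , e₂)

-- Termination on the states of two closed lists.

module Termination {L₁ L₂ : List (Term 0)} (closed₁ : Closed L₁) (closed₂ : Closed L₂) where

  open PairsOf L₁ L₂

  synth-step : ∀ {Γ ρ σ} → ρ ∈ L₁ → σ ∈ L₂ → ¬ InCtx Γ ρ σ →
    (∀ {ρ' σ'} → ρ' ∈ L₁ → σ' ∈ L₂ → SynthHalts (extendCtx Γ ρ σ) ρ' σ') →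
    SynthHalts Γ ρ σ
  synth-step {Γ} {ρ} {σ} mρ mσ ¬in call
    with h , U , c ← closed₁ mρ | h' , U' , c' ← closed₂ mσ = by-heads (unf-head U) (unf-head U') U U' c c'
    where
    by-heads : ∀ {h h'} → IsHead h → IsHead h' → Unf ρ h → Unf σ h' →
      BranchesIn h L₁ → BranchesIn h' L₂ → SynthHalts Γ ρ σ
    by-heads h-one      _          U U' c c' = s-one ¬in U
    by-heads (h-ext _)  h-one      U U' c c' =
      s-other ¬in (λ V → case unf-det U V of λ ()) (one-not-choice U' ∘ proj₂)
    by-heads (h-int _)  h-one      U U' c c' =
      s-other ¬in (λ V → case unf-det U V of λ ()) (one-not-choice U' ∘ proj₂)
    by-heads (h-ext _)  (h-ext _)  U U' c c' =
      s-ext-ext ¬in U U' (λ m → call (c m) mσ) (λ m → call mρ (c' m))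
    by-heads (h-int _)  (h-int _)  U U' c c' =
      s-int-int ¬in U U' (λ m → call (c m) mσ) (λ m → call mρ (c' m))
    by-heads (h-int _)  (h-ext _)  U U' c c' =
      s-int-ext ¬in U U' (λ m → call (c m) mσ) (λ m m' → call (c m) (c' m')) (λ m → call mρ (c' m))
    by-heads (h-ext _)  (h-int _)  U U' c c' =
      s-ext-int ¬in U U' (λ m → call mρ (c' m)) (λ m m' → call (c m) (c' m')) (λ m → call (c m) mσ)

  regular₁ : ∀ {s} → s ∈ L₁ → Regular s
  regular₁ ms = L₁ , closed₁ , ms

  regular₂ : ∀ {u} → u ∈ L₂ → Regular u
  regular₂ mu = L₂ , closed₂ , mu

  unassumed : ∀ {Γ} → RegularCtx Γ → ℕ
  unassumed reg =
    count (λ p → ¬? (InCtx? reg (regular₁ (fst∈ p)) (regular₂ (snd∈ p)))) pairs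

  assume-decreases : ∀ {Γ ρ σ} (reg : RegularCtx Γ) (mρ : ρ ∈ L₁) (mσ : σ ∈ L₂) →
    ¬ InCtx Γ ρ σ → unassumed ((regular₁ mρ , regular₂ mσ) ∷ reg) < unassumed reg
  assume-decreases {Γ} {ρ} {σ} reg mρ mσ ¬in =
    count-< _ _ (λ ¬in' assumed → ¬in' (InCtx-there assumed))
      (any-at (λ s u → ¬ InCtx Γ s u × ¬ ¬ InCtx (extendCtx Γ ρ σ) s u) mρ mσ (¬in , λ ¬now → ¬now now))
    where
    now : InCtx (extendCtx Γ ρ σ) ρ σ
    now = fresh Γ , ρ , σ , here refl , ≈-refl closed₁ mρ , ≈-refl closed₂ mσ

  halts : ∀ fuel {Γ ρ σ} (reg : RegularCtx Γ) → unassumed reg < fuel →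
    ρ ∈ L₁ → σ ∈ L₂ → SynthHalts Γ ρ σ
  halts zero       reg ()    mρ mσ
  halts (suc fuel) reg bound mρ mσ with InCtx? reg (regular₁ mρ) (regular₂ mσ)
  ... | yes assumed = s-hyp assumed
  ... | no ¬in = synth-step mρ mσ ¬in
                   (halts fuel ((regular₁ mρ , regular₂ mσ) ∷ reg)
                      (<-≤-trans (assume-decreases reg mρ mσ ¬in) (≤-pred bound)))

mainTheorem4 : (Γ : Ctx) → WFCtx Γ → (ρ σ : Contract) →
    SynthHalts Γ (Contract.term ρ) (Contract.term σ)
mainTheorem4 Γ wfΓ (contract ρ wfρ) (contract σ wfσ) =
  halts (suc (unassumed reg)) reg ≤-refl (∈cl ρ) (∈cl σ)
  where
  open Termination (cl-closed ρ wfρ) (cl-closed σ wfσ)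
  reg : RegularCtx Γ
  reg = All.map (λ {A} (wl , wr) → regular (Assumption.lhs A) wl , regular (Assumption.rhs A) wr) wfΓ
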